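{- Let $\ell_0\ge1$ be an integer such that $\limsup_{m\in\mathscr{V}^{\ell_0}}\mathrm{A}(m)=\infty$ (i.e. the multiplicities $\mathrm{A}(m)$, $m\in\mathscr{V}^{\ell_0}$, are unbounded). Then for every integer $n\ge0$, $\limsup_{m\in\mathscr{V}^{\ell_0+n}}\mathrm{A}(m)=\infty$.
   Context: $\phi$ is Euler's totient function, $\mathscr{V}=\{\phi(n):n\ge1\}$ is the set of totients, $\mathrm{A}(m)=|\phi^{ -1}(m)|$, and for $\ell\ge1$, $\mathscr{V}^{\ell}=\{m\in\mathscr{V}: m\equiv 2^{\ell}\pmod{2^{\ell+1}}\}$ (totients with $2$-adic valuation exactly $\ell$). -}

module Defs where

open import Data.Nat using (ℕ; zero; suc; _+_; _*_; _^_; _≤_; _≥_)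
open import Data.Nat.GCD using (gcd)
open import Data.List using (List; length; filter; upTo; map)
open import Data.List.Relation.Unary.All using (All)
open import Data.List.Relation.Unary.Unique.Propositional using (Unique)
open import Data.Product using (∃; _×_)
open import Relation.Binary.PropositionalEquality using (_≡_)
open import Data.Nat.Properties using (_≟_)

φ : ℕ → ℕ
φ n = length (filter (λ k → gcd (suc k) n ≟ 1) (upTo n))

IsTotient : ℕ → Set
IsTotient m = ∃ λ n → (n ≥ 1) × (φ n ≡ m)

InV : ℕ → ℕ → Set
InV ℓ m = IsTotient m × (∃ λ q → m ≡ 2 ^ ℓ + q * 2 ^ (suc ℓ))

-- A(m) ≥ k, i.e. |φ⁻¹(m)| ≥ k : there are k distinct n ≥ 1 with φ n = m
AtLeast : ℕ → ℕ → Set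
AtLeast k m = ∃ λ (ns : List ℕ) → Unique ns × All (λ n → (n ≥ 1) × (φ n ≡ m)) ns × (length ns ≡ k)

UnboundedOn : ℕ → Set
UnboundedOn ℓ = ∀ (B : ℕ) → ∃ λ m → InV ℓ m × AtLeast B m

-- For even n, φ(2n) = 2φ(n); for odd n, φ(4n) = 2φ(n). So among the preimages of m
-- under φ, the even ones n give preimages 2n of 2m and the odd ones give preimages 4n,
-- injectively in each class. One class holds at least half of them, hence
-- A(2m) ≥ A(m)/2, while m ∈ 𝒱^ℓ gives 2m ∈ 𝒱^(ℓ+1). Iterate the doubling.
module Submission where

open import Defs
open import Data.Nat
open import Data.Nat.Properties
open import Data.Nat.Divisibility
open import Data.Nat.Coprimality using (Coprime; coprime?; coprime-+; coprime-divisor; gcd≡1⇒coprime; coprime⇒gcd≡1)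
open import Data.Nat.Primality using (prime?; prime⇒irreducible)
open import Data.Nat.Tactic.RingSolver using (solve-∀)
open import Data.List using (List; []; _∷_; _++_; length; filter; map; take; upTo; applyUpTo)
open import Data.List.Properties using (length-++; length-map; length-take; filter-++; filter-≐; map-upTo; map-applyUpTo)
open import Data.List.Relation.Unary.All as All using (All)
import Data.List.Relation.Unary.All.Properties as All
open import Data.List.Relation.Unary.Unique.Propositional using (Unique)
import Data.List.Relation.Unary.Unique.Propositional.Properties as Unique
open import Data.Product using (_,_; _×_; proj₁; proj₂)
open import Data.Sum using (_⊎_; inj₁; inj₂)
open import Function using (_∘_)
open import Level using (0ℓ)
open import Relation.Nullary using (¬_; yes; no; contradiction)
open import Relation.Nullary.Decidable using (from-yes)
open import Relation.Unary using (Pred; Decidable; _≐_; _∪_; _∩_; Empty)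
open import Relation.Unary.Properties using (_∪?_; ∁?; ≐-trans)
open import Relation.Binary.PropositionalEquality

private
  variable
    A : Set
    B ℓ m n : ℕ

applyUpTo-cong : ∀ {f g : ℕ → A} → (∀ k → f k ≡ g k) → ∀ n → applyUpTo f n ≡ applyUpTo g n
applyUpTo-cong f≗g zero    = refl
applyUpTo-cong f≗g (suc n) = cong₂ _∷_ (f≗g 0) (applyUpTo-cong (f≗g ∘ suc) n)

applyUpTo-+ : ∀ (f : ℕ → A) m n → applyUpTo f (m + n) ≡ applyUpTo f m ++ applyUpTo (f ∘ (m +_)) n
applyUpTo-+ f zero    n = refl
applyUpTo-+ f (suc m) n = cong (f 0 ∷_) (applyUpTo-+ (f ∘ suc) m n)

[1‥_] : ℕ → List ℕ
[1‥ n ] = applyUpTo suc n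

[1‥+] : ∀ m n → [1‥ m + n ] ≡ [1‥ m ] ++ map (m +_) [1‥ n ]
[1‥+] m n = begin
  applyUpTo suc (m + n)                           ≡⟨ applyUpTo-+ suc m n ⟩
  [1‥ m ] ++ applyUpTo (suc ∘ (m +_)) n           ≡⟨ cong ([1‥ m ] ++_) (applyUpTo-cong (λ k → sym (+-suc m k)) n) ⟩
  [1‥ m ] ++ applyUpTo ((m +_) ∘ suc) n           ≡⟨ cong ([1‥ m ] ++_) (map-applyUpTo suc (m +_) n) ⟨
  [1‥ m ] ++ map (m +_) [1‥ n ]                   ∎
  where open ≡-Reasoning

count : ∀ {P : Pred A 0ℓ} → Decidable P → List A → ℕ
count P? xs = length (filter P? xs)

module _ {P : Pred A 0ℓ} where

  count-++ : ∀ (P? : Decidable P) xs ys → count P? (xs ++ ys) ≡ count P? xs + count P? ys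
  count-++ P? xs ys = trans (cong length (filter-++ P? xs ys)) (length-++ (filter P? xs))

  count-≐ : ∀ {Q : Pred A 0ℓ} (P? : Decidable P) (Q? : Decidable Q) → P ≐ Q → ∀ xs → count P? xs ≡ count Q? xs
  count-≐ P? Q? P≐Q xs = cong length (filter-≐ P? Q? P≐Q xs)

  count-∪ : ∀ {Q : Pred A 0ℓ} (P? : Decidable P) (Q? : Decidable Q) → Empty (P ∩ Q) →
            ∀ xs → count P? xs + count Q? xs ≡ count (P? ∪? Q?) xs
  count-∪ P? Q? disjoint [] = refl
  count-∪ P? Q? disjoint (x ∷ xs) with ih ← count-∪ P? Q? disjoint xs | P? x | Q? x
  ... | yes p | yes q = contradiction (p , q) (disjoint x)
  ... | yes _ | no _  = cong suc ih
  ... | no _  | yes _ = trans (+-suc _ _) (cong suc ih)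
  ... | no _  | no _  = ih

  count+count-∁ : ∀ (P? : Decidable P) xs → count P? xs + count (∁? P?) xs ≡ length xs
  count+count-∁ P? [] = refl
  count+count-∁ P? (x ∷ xs) with ih ← count+count-∁ P? xs | P? x
  ... | yes _ = cong suc ih
  ... | no _  = trans (+-suc _ _) (cong suc ih)

count-map : ∀ {A′ : Set} {P : Pred A′ 0ℓ} (P? : Decidable P) (f : A → A′) xs → count P? (map f xs) ≡ count (P? ∘ f) xs
count-map P? f [] = refl
count-map P? f (x ∷ xs) with P? (f x)
... | yes _ = cong suc (count-map P? f xs)
... | no _  = count-map P? f xs

¬2∣⇒2∣suc : ¬ 2 ∣ n → 2 ∣ suc n
¬2∣⇒2∣suc {zero}        odd = contradiction (divides 0 refl) odd
¬2∣⇒2∣suc {suc zero}    odd = ∣-refl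
¬2∣⇒2∣suc {suc (suc n)} odd = ∣m∣n⇒∣m+n ∣-refl (¬2∣⇒2∣suc (odd ∘ ∣m∣n⇒∣m+n ∣-refl))

odd+odd : ¬ 2 ∣ m → ¬ 2 ∣ n → 2 ∣ m + n
odd+odd {m} {n} m-odd n-odd with 2 ∣? (m + n)
... | yes even = even
... | no odd   = contradiction (∣m+n∣m⇒∣n (¬2∣⇒2∣suc odd) (¬2∣⇒2∣suc m-odd)) n-odd

odd+even : ¬ 2 ∣ m → 2 ∣ n → ¬ 2 ∣ m + n
odd+even {m} {n} m-odd n-even even = m-odd (∣m+n∣m⇒∣n (subst (2 ∣_) (+-comm m n) even) n-even)

CoprimeTo : ℕ → Pred ℕ 0ℓ
CoprimeTo n x = Coprime x n

coprimeTo? : ∀ n → Decidable (CoprimeTo n)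
coprimeTo? n x = coprime? x n

coprimeTo-shift : (CoprimeTo n ∘ (n +_)) ≐ CoprimeTo n
coprimeTo-shift = (λ c (d∣x , d∣n) → c (∣m∣n⇒∣m+n d∣n d∣x , d∣n)) , coprime-+

coprimeTo-2*⇒coprimeTo : CoprimeTo (2 * n) m → CoprimeTo n m
coprimeTo-2*⇒coprimeTo c (d∣m , d∣n) = c (d∣m , ∣n⇒∣m*n 2 d∣n)

coprimeTo-2*⇒odd : CoprimeTo (2 * n) m → ¬ 2 ∣ m
coprimeTo-2*⇒odd {n} c 2∣m with () ← c (2∣m , m∣m*n n)

coprimeTo∧odd⇒coprimeTo-2* : CoprimeTo n m → ¬ 2 ∣ m → CoprimeTo (2 * n) m
coprimeTo∧odd⇒coprimeTo-2* {n} c m-odd {d} (d∣m , d∣2n)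
  with prime⇒irreducible (from-yes (prime? 2)) d∣2
  where
  d∣2 : d ∣ 2
  d∣2 = coprime-divisor (λ (e∣d , e∣n) → c (∣-trans e∣d d∣m , e∣n)) (subst (d ∣_) (*-comm 2 n) d∣2n)
... | inj₁ d≡1 = d≡1
... | inj₂ refl = contradiction d∣m m-odd

coprimeTo-2*-even : 2 ∣ n → CoprimeTo (2 * n) ≐ CoprimeTo n
coprimeTo-2*-even 2∣n =
  coprimeTo-2*⇒coprimeTo , λ c → coprimeTo∧odd⇒coprimeTo-2* c (λ 2∣m → contradiction (c (2∣m , 2∣n)) λ ())

-- For odd n, exactly one of x and n + x is odd.
coprimeTo-2*-odd-disjoint : ¬ 2 ∣ n → Empty (CoprimeTo (2 * n) ∩ (CoprimeTo (2 * n) ∘ (n +_)))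
coprimeTo-2*-odd-disjoint {n} n-odd x (c , c′) =
  coprimeTo-2*⇒odd {n} c′ (odd+odd n-odd (coprimeTo-2*⇒odd {n} c))

coprimeTo-2*-odd : ¬ 2 ∣ n → (CoprimeTo (2 * n) ∪ (CoprimeTo (2 * n) ∘ (n +_))) ≐ CoprimeTo n
coprimeTo-2*-odd {n} n-odd = sound , complete
  where
  sound : ∀ {x} → CoprimeTo (2 * n) x ⊎ CoprimeTo (2 * n) (n + x) → CoprimeTo n x
  sound (inj₁ c) = coprimeTo-2*⇒coprimeTo c
  sound (inj₂ c) = proj₁ coprimeTo-shift (coprimeTo-2*⇒coprimeTo c)
  complete : ∀ {x} → CoprimeTo n x → CoprimeTo (2 * n) x ⊎ CoprimeTo (2 * n) (n + x)
  complete {x} c with 2 ∣? x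
  ... | no x-odd   = inj₁ (coprimeTo∧odd⇒coprimeTo-2* c x-odd)
  ... | yes x-even = inj₂ (coprimeTo∧odd⇒coprimeTo-2* (coprime-+ c) (odd+even n-odd x-even))

φ≡count-coprimeTo : ∀ n → φ n ≡ count (coprimeTo? n) [1‥ n ]
φ≡count-coprimeTo n = begin
  φ n                                           ≡⟨ count-≐ _ (coprimeTo? n ∘ suc) (gcd≡1⇒coprime , coprime⇒gcd≡1) (upTo n) ⟩
  count (coprimeTo? n ∘ suc) (upTo n)           ≡⟨ count-map (coprimeTo? n) suc (upTo n) ⟨
  count (coprimeTo? n) (map suc (upTo n))       ≡⟨ cong (count (coprimeTo? n)) (map-upTo suc n) ⟩
  count (coprimeTo? n) [1‥ n ]                  ∎
  where open ≡-Reasoning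

φ-2*≡halves : ∀ n → φ (2 * n) ≡ count (coprimeTo? (2 * n)) [1‥ n ] + count (coprimeTo? (2 * n) ∘ (n +_)) [1‥ n ]
φ-2*≡halves n = begin
  φ (2 * n)                                     ≡⟨ φ≡count-coprimeTo (2 * n) ⟩
  count C? [1‥ 2 * n ]                          ≡⟨ cong (λ k → count C? [1‥ k ]) (cong (n +_) (+-identityʳ n)) ⟩
  count C? [1‥ n + n ]                          ≡⟨ cong (count C?) ([1‥+] n n) ⟩
  count C? ([1‥ n ] ++ map (n +_) [1‥ n ])      ≡⟨ count-++ C? [1‥ n ] (map (n +_) [1‥ n ]) ⟩
  count C? [1‥ n ] + count C? (map (n +_) [1‥ n ])  ≡⟨ cong (count C? [1‥ n ] +_) (count-map C? (n +_) [1‥ n ]) ⟩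
  count C? [1‥ n ] + count (C? ∘ (n +_)) [1‥ n ]    ∎
  where
  open ≡-Reasoning
  C? = coprimeTo? (2 * n)

φ-2*-even : 2 ∣ n → φ (2 * n) ≡ 2 * φ n
φ-2*-even {n} 2∣n = begin
  φ (2 * n)                                     ≡⟨ φ-2*≡halves n ⟩
  count C? [1‥ n ] + count (C? ∘ (n +_)) [1‥ n ]  ≡⟨ cong₂ _+_ (count-≐ C? (coprimeTo? n) (coprimeTo-2*-even {n} 2∣n) [1‥ n ])
                                                               (count-≐ _ (coprimeTo? n) (≐-trans shifted coprimeTo-shift) [1‥ n ]) ⟩
  count (coprimeTo? n) [1‥ n ] + count (coprimeTo? n) [1‥ n ]  ≡⟨ cong (λ k → k + k) (φ≡count-coprimeTo n) ⟨
  φ n + φ n                                     ≡⟨ cong (φ n +_) (+-identityʳ (φ n)) ⟨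
  2 * φ n                                       ∎
  where
  open ≡-Reasoning
  C? = coprimeTo? (2 * n)
  shifted : (CoprimeTo (2 * n) ∘ (n +_)) ≐ (CoprimeTo n ∘ (n +_))
  shifted = proj₁ (coprimeTo-2*-even 2∣n) , proj₂ (coprimeTo-2*-even 2∣n)

φ-2*-odd : ¬ 2 ∣ n → φ (2 * n) ≡ φ n
φ-2*-odd {n} n-odd = begin
  φ (2 * n)                                     ≡⟨ φ-2*≡halves n ⟩
  count C? [1‥ n ] + count (C? ∘ (n +_)) [1‥ n ]  ≡⟨ count-∪ C? (C? ∘ (n +_)) (coprimeTo-2*-odd-disjoint n-odd) [1‥ n ] ⟩
  count (C? ∪? (C? ∘ (n +_))) [1‥ n ]           ≡⟨ count-≐ _ (coprimeTo? n) (coprimeTo-2*-odd n-odd) [1‥ n ] ⟩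
  count (coprimeTo? n) [1‥ n ]                  ≡⟨ φ≡count-coprimeTo n ⟨
  φ n                                           ∎
  where
  open ≡-Reasoning
  C? = coprimeTo? (2 * n)

Preimage : ℕ → Pred ℕ 0ℓ
Preimage m n = n ≥ 1 × φ n ≡ m

preimage-2*-even : 2 ∣ n → Preimage m n → Preimage (2 * m) (2 * n)
preimage-2*-even {suc _} 2∣n (_ , φn≡m) = s≤s z≤n , trans (φ-2*-even 2∣n) (cong (2 *_) φn≡m)

preimage-4*-odd : ¬ 2 ∣ n → Preimage m n → Preimage (2 * m) (2 * (2 * n))
preimage-4*-odd {suc n} n-odd (_ , φn≡m) =
  s≤s z≤n , trans (φ-2*-even (m∣m*n (suc n))) (cong (2 *_) (trans (φ-2*-odd n-odd) φn≡m))

totient-2* : IsTotient m → IsTotient (2 * m)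
totient-2* (n , pre) with 2 ∣? n
... | yes 2∣n  = 2 * n , preimage-2*-even 2∣n pre
... | no n-odd = 2 * (2 * n) , preimage-4*-odd n-odd pre

inV-2* : InV ℓ m → InV (suc ℓ) (2 * m)
inV-2* {ℓ} (t , q , m≡) = totient-2* t , q , trans (cong (2 *_) m≡) (shift (2 ^ ℓ) q)
  where
  shift : ∀ a q → 2 * (a + q * (2 * a)) ≡ 2 * a + q * (2 * (2 * a))
  shift = solve-∀

atLeast-≤ : ∀ {ns} → Unique ns → All (Preimage m) ns → B ≤ length ns → AtLeast B m
atLeast-≤ {B = B} {ns} unique pre B≤ =
  take B ns , Unique.take⁺ B unique , All.take⁺ B pre , trans (length-take B ns) (m≤n⇒m⊓n≡m B≤)

atLeast-image : ∀ {P : Pred ℕ 0ℓ} {m′ ns} (P? : Decidable P) (f : ℕ → ℕ) →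
                (∀ {x y} → f x ≡ f y → x ≡ y) → (∀ {n} → P n → Preimage m n → Preimage m′ (f n)) →
                Unique ns → All (Preimage m) ns → B ≤ count P? ns → AtLeast B m′
atLeast-image {ns = ns} P? f f-injective f-preimage unique pre B≤ =
  atLeast-≤ (Unique.map⁺ f-injective (Unique.filter⁺ P? unique))
            (All.map⁺ (All.map (λ (p , q) → f-preimage p q) (All.zip (All.all-filter P? ns , All.filter⁺ P? pre))))
            (subst (_ ≤_) (sym (length-map f (filter P? ns))) B≤)

+-pigeonhole : B + B ≤ m + n → B ≤ m ⊎ B ≤ n
+-pigeonhole {B} {m} {n} B+B≤ with B ≤? m
... | yes B≤m = inj₁ B≤m
... | no B≰m  = inj₂ (<⇒≤ (+-cancelˡ-< B B n (≤-<-trans B+B≤ (+-monoˡ-< n (≰⇒> B≰m)))))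

atLeast-2* : AtLeast (B + B) m → AtLeast B (2 * m)
atLeast-2* (ns , unique , pre , length≡2B)
  with +-pigeonhole (≤-reflexive (trans (sym length≡2B) (sym (count+count-∁ (2 ∣?_) ns))))
... | inj₁ B≤evens = atLeast-image (2 ∣?_) (2 *_) (*-cancelˡ-≡ _ _ 2) preimage-2*-even unique pre B≤evens
... | inj₂ B≤odds  = atLeast-image (∁? (2 ∣?_)) (λ n → 2 * (2 * n)) (*-cancelˡ-≡ _ _ 2 ∘ *-cancelˡ-≡ _ _ 2)
                                   preimage-4*-odd unique pre B≤odds

unboundedOn-suc : ∀ ℓ → UnboundedOn ℓ → UnboundedOn (suc ℓ)
unboundedOn-suc ℓ unbounded B =
  let m , m∈𝒱 , A[m]≥2B = unbounded (B + B) in 2 * m , inV-2* {ℓ} m∈𝒱 , atLeast-2* A[m]≥2B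

unboundedOn-+ : ∀ ℓ → UnboundedOn ℓ → ∀ n → UnboundedOn (ℓ + n)
unboundedOn-+ ℓ unbounded zero    = subst UnboundedOn (sym (+-identityʳ ℓ)) unbounded
unboundedOn-+ ℓ unbounded (suc n) =
  subst UnboundedOn (sym (+-suc ℓ n)) (unboundedOn-suc (ℓ + n) (unboundedOn-+ ℓ unbounded n))

proposition3p1 : (ℓ₀ : ℕ) → ℓ₀ ≥ 1 → UnboundedOn ℓ₀ → (n : ℕ) → UnboundedOn (ℓ₀ + n)
proposition3p1 ℓ₀ _ = unboundedOn-+ ℓ₀
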